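{- Let $n\ge 3$ be an integer and let $a_1,\dots,a_n$ be arbitrary nonzero integers. Let $r_1,\dots,r_n$ be arbitrary nonzero rational numbers, let $p_1,\dots,p_n$ be rational numbers with $p_i\neq p_{i+1}$ for $i=1,\dots,n$, where $p_{n+1}=p_1$, and let $q_1,\dots,q_n$ be arbitrary rational numbers, with $q_{n+1}=q_1$. Define, for $i=1,\dots,n$, \[ g_i=\frac{p_i-p_{i+1}}{a_i r_i^3},\qquad f_i=\frac{q_i-q_{i+1}}{a_i g_i r_i^2}, \] then \[ u=\sum_{i=1}^n a_i g_i r_i(3f_i^2+g_i^2),\qquad v=-\sum_{i=1}^n a_i f_i g_i (f_i^2+g_i^2), \] and finally \[ x_i=(f_i+g_i)u+r_i v,\qquad y_i=(f_i-g_i)u+r_i v,\qquad i=1,\dots,n. \] Then the rational numbers $x_i,y_i$ satisfy \[ \sum_{i=1}^n a_i x_i^4=\sum_{i=1}^n a_i y_i^4 . \] -}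

module Defs where

open import Data.Nat using (ℕ; zero; suc)
open import Data.Fin using (Fin; zero; suc; fromℕ; inject₁)
open import Data.Integer using (ℤ)
open import Data.Rational using (ℚ; 0ℚ; _+_; _*_; _-_; -_; 1/_; _/_; ≢-nonZero)
open import Relation.Nullary using (yes; no)
open import Relation.Binary.PropositionalEquality using (_≡_)

-- total reciprocal: inv p = 1/p for p ≠ 0 (and 0 for p = 0; only used at nonzero p)
inv : ℚ → ℚ
inv p with p Data.Rational.≟ 0ℚ
... | yes _ = 0ℚ
... | no p≢0 = 1/_ p {{≢-nonZero p≢0}}

_÷'_ : ℚ → ℚ → ℚ
x ÷' y = x * inv y
infixl 7 _÷'_

ι : ℤ → ℚ
ι z = z / 1

Σ : (n : ℕ) → (Fin n → ℚ) → ℚ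
Σ zero f = 0ℚ
Σ (suc n) f = f zero + Σ n (λ i → f (suc i))

-- cyclic successor on Fin n: i ↦ i+1, with n-1 ↦ 0 (so index n+1 = index 1)
next : {n : ℕ} → Fin n → Fin n
next {suc zero} zero = zero
next {suc (suc n)} zero = suc zero
next {suc (suc n)} (suc i) with next {suc n} i
... | zero = zero      -- i was the last index of Fin (suc n): wrap around
... | suc j = suc (suc j)

_^2 _^3 _^4 : ℚ → ℚ
x ^2 = x * x
x ^3 = x * x * x
x ^4 = x ^2 * x ^2

module Construction (n : ℕ) (a : Fin n → ℤ) (r p q : Fin n → ℚ) where
  A : Fin n → ℚ
  A i = ι (a i)

  g : Fin n → ℚ
  g i = (p i - p (next i)) ÷' (A i * (r i) ^3)

  f : Fin n → ℚ
  f i = (q i - q (next i)) ÷' (A i * g i * (r i) ^2)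

  u : ℚ
  u = Σ n (λ i → A i * g i * r i * (ι (Data.Integer.+ 3) * (f i) ^2 + (g i) ^2))

  v : ℚ
  v = - Σ n (λ i → A i * f i * g i * ((f i) ^2 + (g i) ^2))

  x : Fin n → ℚ
  x i = (f i + g i) * u + r i * v

  y : Fin n → ℚ
  y i = (f i - g i) * u + r i * v

-- Write sᵢ = fᵢu + rᵢv and tᵢ = gᵢu, so that xᵢ = sᵢ + tᵢ and yᵢ = sᵢ - tᵢ.
-- Then xᵢ⁴ - yᵢ⁴ = 8sᵢ³tᵢ + 8sᵢtᵢ³, and expanding in u and v gives
--   aᵢ(xᵢ⁴ - yᵢ⁴) = 8u⁴·W₁ᵢ + 8u³v·W₂ᵢ + 24u²v²·W₃ᵢ + 8uv³·W₄ᵢ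
-- with the weights  W₁ = a f g (f² + g²),  W₂ = a g r (3f² + g²),
-- W₃ = a g f r²  and  W₄ = a g r³.  By construction Σ W₁ = -v and Σ W₂ = u,
-- so the first two terms cancel after summation, while the definitions of
-- g and f make W₄ᵢ = pᵢ - pᵢ₊₁ and W₃ᵢ = qᵢ - qᵢ₊₁, whose cyclic sums
-- telescope to 0.  The hypotheses aᵢ, rᵢ ≠ 0 and pᵢ ≠ pᵢ₊₁ are exactly what
-- makes the divisions defining g and f honest.
module Submission where

open import Defs
open import Data.Nat using (ℕ; _≥_; zero; suc)
open import Data.Fin using (Fin; zero; suc)
open import Data.Integer using (ℤ)
import Data.Integer as ℤ
import Data.Integer.Properties as ℤP
open import Data.Integer.GCD using (gcd)
open import Data.Rational using (ℚ; 0ℚ; 1ℚ; _*_; _+_; _-_; -_; ↥_; ≢-nonZero)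
open import Data.Rational.Properties using (*-inverseˡ; +-identityʳ; 1≢0; ↥-/; p≡0⇒↥p≡0)
open import Data.Rational.Solver using (module +-*-Solver)
open import Data.Empty using (⊥-elim)
open import Relation.Nullary using (yes; no)
open import Relation.Binary.PropositionalEquality
open ≡-Reasoning
open +-*-Solver

Σ-cong : ∀ n {f h : Fin n → ℚ} → (∀ i → f i ≡ h i) → Σ n f ≡ Σ n h
Σ-cong zero    e = refl
Σ-cong (suc n) e = cong₂ _+_ (e zero) (Σ-cong n (λ i → e (suc i)))

Σ-+ : ∀ n (f h : Fin n → ℚ) → Σ n (λ i → f i + h i) ≡ Σ n f + Σ n h
Σ-+ zero    f h = refl
Σ-+ (suc n) f h = begin
  f zero + h zero + Σ n (λ i → f (suc i) + h (suc i))
    ≡⟨ cong (f zero + h zero +_) (Σ-+ n _ _) ⟩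
  f zero + h zero + (Σ n (λ i → f (suc i)) + Σ n (λ i → h (suc i)))
    ≡⟨ solve 4 (λ a b c d → a :+ b :+ (c :+ d) := a :+ c :+ (b :+ d)) refl (f zero) (h zero) _ _ ⟩
  f zero + Σ n (λ i → f (suc i)) + (h zero + Σ n (λ i → h (suc i))) ∎

Σ-* : ∀ n c (f : Fin n → ℚ) → Σ n (λ i → c * f i) ≡ c * Σ n f
Σ-* zero    c f = solve 1 (λ c → con 0ℚ := c :* con 0ℚ) refl c
Σ-* (suc n) c f = begin
  c * f zero + Σ n (λ i → c * f (suc i)) ≡⟨ cong (c * f zero +_) (Σ-* n c _) ⟩
  c * f zero + c * Σ n (λ i → f (suc i)) ≡⟨ solve 3 (λ c a b → c :* a :+ c :* b := c :* (a :+ b)) refl c (f zero) _ ⟩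
  c * (f zero + Σ n (λ i → f (suc i)))   ∎

Σ-- : ∀ n (f h : Fin n → ℚ) → Σ n (λ i → f i - h i) ≡ Σ n f - Σ n h
Σ-- n f h = begin
  Σ n (λ i → f i - h i)           ≡⟨ Σ-cong n (λ i → solve 2 (λ a b → a :- b := a :+ con (- 1ℚ) :* b) refl (f i) (h i)) ⟩
  Σ n (λ i → f i + (- 1ℚ) * h i)  ≡⟨ Σ-+ n _ _ ⟩
  Σ n f + Σ n (λ i → (- 1ℚ) * h i) ≡⟨ cong (Σ n f +_) (Σ-* n (- 1ℚ) h) ⟩
  Σ n f + (- 1ℚ) * Σ n h          ≡⟨ solve 2 (λ a b → a :+ con (- 1ℚ) :* b := a :- b) refl (Σ n f) (Σ n h) ⟩
  Σ n f - Σ n h                   ∎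

Σ-combination : ∀ n (c₁ c₂ c₃ c₄ : ℚ) (W₁ W₂ W₃ W₄ : Fin n → ℚ) →
  Σ n (λ i → c₁ * W₁ i + c₂ * W₂ i + c₃ * W₃ i + c₄ * W₄ i)
    ≡ c₁ * Σ n W₁ + c₂ * Σ n W₂ + c₃ * Σ n W₃ + c₄ * Σ n W₄
Σ-combination n c₁ c₂ c₃ c₄ W₁ W₂ W₃ W₄ = begin
  Σ n (λ i → c₁ * W₁ i + c₂ * W₂ i + c₃ * W₃ i + c₄ * W₄ i)
    ≡⟨ trans (Σ-+ n _ _) (cong (_+ _) (trans (Σ-+ n _ _) (cong (_+ _) (Σ-+ n _ _)))) ⟩
  Σ n (λ i → c₁ * W₁ i) + Σ n (λ i → c₂ * W₂ i) + Σ n (λ i → c₃ * W₃ i) + Σ n (λ i → c₄ * W₄ i)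
    ≡⟨ cong₂ _+_ (cong₂ _+_ (cong₂ _+_ (Σ-* n c₁ W₁) (Σ-* n c₂ W₂)) (Σ-* n c₃ W₃)) (Σ-* n c₄ W₄) ⟩
  c₁ * Σ n W₁ + c₂ * Σ n W₂ + c₃ * Σ n W₃ + c₄ * Σ n W₄ ∎

-- Cyclic telescoping.  `skipOne` embeds Fin (m+1) into Fin (m+2) avoiding
-- the index 1; it describes how `next` acts on the indices 1, …, m+1.

skipOne : ∀ {m} → Fin (suc m) → Fin (suc (suc m))
skipOne zero    = zero
skipOne (suc j) = suc (suc j)

next-suc : ∀ {m} (i : Fin (suc m)) → next {suc (suc m)} (suc i) ≡ skipOne (next i)
next-suc i with next i
... | zero  = refl
... | suc j = refl

Σ-next : ∀ m (h : Fin (suc m) → ℚ) → Σ (suc m) (λ i → h (next i)) ≡ Σ m (λ i → h (suc i)) + h zero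
Σ-next zero    h = solve 1 (λ a → a :+ con 0ℚ := con 0ℚ :+ a) refl (h zero)
Σ-next (suc k) h = begin
  h (suc zero) + Σ (suc k) (λ i → h (next (suc i)))
    ≡⟨ cong (h (suc zero) +_) (Σ-cong (suc k) (λ i → cong h (next-suc i))) ⟩
  h (suc zero) + Σ (suc k) (λ i → h (skipOne (next i)))
    ≡⟨ cong (h (suc zero) +_) (Σ-next k (λ i → h (skipOne i))) ⟩
  h (suc zero) + (Σ k (λ i → h (suc (suc i))) + h zero)
    ≡⟨ solve 3 (λ a b c → a :+ (b :+ c) := a :+ b :+ c) refl (h (suc zero)) _ (h zero) ⟩
  h (suc zero) + Σ k (λ i → h (suc (suc i))) + h zero ∎

-- A cyclic difference sums to zero: every hᵢ occurs once with each sign.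
telescope : ∀ n (h : Fin n → ℚ) → Σ n (λ i → h i - h (next i)) ≡ 0ℚ
telescope zero    h = refl
telescope (suc m) h = begin
  Σ (suc m) (λ i → h i - h (next i))           ≡⟨ Σ-- (suc m) h (λ i → h (next i)) ⟩
  Σ (suc m) h - Σ (suc m) (λ i → h (next i))   ≡⟨ cong (λ z → Σ (suc m) h - z) (Σ-next m h) ⟩
  (h zero + Σ m (λ i → h (suc i))) - (Σ m (λ i → h (suc i)) + h zero)
    ≡⟨ solve 2 (λ a b → (a :+ b) :- (b :+ a) := con 0ℚ) refl (h zero) _ ⟩
  0ℚ ∎

inv-inverseˡ : ∀ w → w ≢ 0ℚ → inv w * w ≡ 1ℚ
inv-inverseˡ w w≢0 with w Data.Rational.≟ 0ℚ
... | yes w≡0 = ⊥-elim (w≢0 w≡0)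
... | no  w≢0 = *-inverseˡ w {{≢-nonZero w≢0}}

÷'-cancel : ∀ c w → w ≢ 0ℚ → c ÷' w * w ≡ c
÷'-cancel c w w≢0 = begin
  c * inv w * w   ≡⟨ solve 3 (λ c i w → c :* i :* w := c :* (i :* w)) refl c (inv w) w ⟩
  c * (inv w * w) ≡⟨ cong (c *_) (inv-inverseˡ w w≢0) ⟩
  c * 1ℚ          ≡⟨ solve 1 (λ c → c :* con 1ℚ := c) refl c ⟩
  c               ∎

-- A nonzero integer is a nonzero rational: the numerator of a / 1 is a.
ι-≢0 : ∀ a → a ≢ ℤ.0ℤ → ι a ≢ 0ℚ
ι-≢0 a a≢0 ιa≡0 = a≢0 (begin
  a                         ≡⟨ sym (↥-/ a 1) ⟩
  ↥ (ι a) ℤ.* gcd a (ℤ.+ 1) ≡⟨ cong (ℤ._* gcd a (ℤ.+ 1)) (p≡0⇒↥p≡0 (ι a) ιa≡0) ⟩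
  ℤ.0ℤ ℤ.* gcd a (ℤ.+ 1)    ≡⟨ ℤP.*-zeroˡ (gcd a (ℤ.+ 1)) ⟩
  ℤ.0ℤ                      ∎)

-- ℚ has no zero divisors: multiply x * y = 0 by inv x.
*-≢0 : ∀ x y → x ≢ 0ℚ → y ≢ 0ℚ → x * y ≢ 0ℚ
*-≢0 x y x≢0 y≢0 xy≡0 = y≢0 (begin
  y               ≡⟨ solve 1 (λ y → y := con 1ℚ :* y) refl y ⟩
  1ℚ * y          ≡⟨ cong (_* y) (sym (inv-inverseˡ x x≢0)) ⟩
  inv x * x * y   ≡⟨ solve 3 (λ i x y → i :* x :* y := i :* (x :* y)) refl (inv x) x y ⟩
  inv x * (x * y) ≡⟨ cong (inv x *_) xy≡0 ⟩
  inv x * 0ℚ      ≡⟨ solve 1 (λ i → i :* con 0ℚ := con 0ℚ) refl (inv x) ⟩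
  0ℚ              ∎)

-- A quotient of nonzero numbers is nonzero (inv w ≠ 0 since inv w * w = 1).
÷'-≢0 : ∀ c w → c ≢ 0ℚ → w ≢ 0ℚ → c ÷' w ≢ 0ℚ
÷'-≢0 c w c≢0 w≢0 = *-≢0 c (inv w) c≢0 inv≢0
  where
  inv≢0 : inv w ≢ 0ℚ
  inv≢0 inv≡0 = 1≢0 (begin
    1ℚ        ≡⟨ sym (inv-inverseˡ w w≢0) ⟩
    inv w * w ≡⟨ cong (_* w) inv≡0 ⟩
    0ℚ * w    ≡⟨ solve 1 (λ w → con 0ℚ :* w := con 0ℚ) refl w ⟩
    0ℚ        ∎)

-≢0 : ∀ x y → x ≢ y → x - y ≢ 0ℚ
-≢0 x y x≢y x-y≡0 = x≢y (begin
  x           ≡⟨ solve 2 (λ x y → x := (x :- y) :+ y) refl x y ⟩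
  (x - y) + y ≡⟨ cong (_+ y) x-y≡0 ⟩
  0ℚ + y      ≡⟨ solve 1 (λ y → con 0ℚ :+ y := y) refl y ⟩
  y           ∎)

-- The pointwise identity behind the construction: with s = fu + rv and
-- t = gu one has (s+t)⁴ - (s-t)⁴ = 8s³t + 8st³, expanded here in u and v.
-- Each bracket on the right is one of the weights W₁, …, W₄ below.
fourth-power-difference : ∀ A f g r u v →
  A * ((f + g) * u + r * v) ^4 ≡
  A * ((f - g) * u + r * v) ^4
    + (ι (ℤ.+ 8)  * (u * u * u * u) * (A * f * g * (f ^2 + g ^2))
    +  ι (ℤ.+ 8)  * (u * u * u * v) * (A * g * r * (ι (ℤ.+ 3) * f ^2 + g ^2))
    +  ι (ℤ.+ 24) * (u * u * v * v) * (A * g * f * r ^2)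
    +  ι (ℤ.+ 8)  * (u * v * v * v) * (A * g * r ^3))
fourth-power-difference = solve 6 (λ A f g r u v →
  let sq  e = e :* e
      _⁴ e  = sq e :* sq e
  in A :* ((f :+ g) :* u :+ r :* v) ⁴ :=
     A :* ((f :- g) :* u :+ r :* v) ⁴
       :+ (con (ι (ℤ.+ 8))  :* (u :* u :* u :* u) :* (A :* f :* g :* (sq f :+ sq g))
       :+  con (ι (ℤ.+ 8))  :* (u :* u :* u :* v) :* (A :* g :* r :* (con (ι (ℤ.+ 3)) :* sq f :+ sq g))
       :+  con (ι (ℤ.+ 24)) :* (u :* u :* v :* v) :* (A :* g :* f :* sq r)
       :+  con (ι (ℤ.+ 8))  :* (u :* v :* v :* v) :* (A :* g :* (r :* r :* r)))) refl

module Weights (n : ℕ) (a : Fin n → ℤ) (r p q : Fin n → ℚ)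
               (a≢0 : ∀ i → a i ≢ ℤ.0ℤ) (r≢0 : ∀ i → r i ≢ 0ℚ)
               (p≢p-next : ∀ i → p i ≢ p (next i)) where
  open Construction n a r p q

  W₁ W₂ W₃ W₄ : Fin n → ℚ
  W₁ i = A i * f i * g i * (f i ^2 + g i ^2)
  W₂ i = A i * g i * r i * (ι (ℤ.+ 3) * f i ^2 + g i ^2)
  W₃ i = A i * g i * f i * r i ^2
  W₄ i = A i * g i * r i ^3

  A·r³≢0 : ∀ i → A i * r i ^3 ≢ 0ℚ
  A·r³≢0 i = *-≢0 _ _ (ι-≢0 (a i) (a≢0 i)) (*-≢0 _ _ (*-≢0 _ _ (r≢0 i) (r≢0 i)) (r≢0 i))

  g≢0 : ∀ i → g i ≢ 0ℚ
  g≢0 i = ÷'-≢0 _ _ (-≢0 (p i) (p (next i)) (p≢p-next i)) (A·r³≢0 i)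

  A·g·r²≢0 : ∀ i → A i * g i * r i ^2 ≢ 0ℚ
  A·g·r²≢0 i = *-≢0 _ _ (*-≢0 _ _ (ι-≢0 (a i) (a≢0 i)) (g≢0 i)) (*-≢0 _ _ (r≢0 i) (r≢0 i))

  -- gᵢ and fᵢ are chosen precisely so that W₄ and W₃ are cyclic differences.
  W₄-difference : ∀ i → W₄ i ≡ p i - p (next i)
  W₄-difference i = begin
    A i * g i * (r i * r i * r i)   ≡⟨ solve 3 (λ A g r → A :* g :* (r :* r :* r) := g :* (A :* (r :* r :* r))) refl (A i) (g i) (r i) ⟩
    g i * (A i * r i ^3)            ≡⟨ ÷'-cancel (p i - p (next i)) (A i * r i ^3) (A·r³≢0 i) ⟩
    p i - p (next i)                ∎

  W₃-difference : ∀ i → W₃ i ≡ q i - q (next i)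
  W₃-difference i = begin
    A i * g i * f i * (r i * r i)   ≡⟨ solve 4 (λ A g f r → A :* g :* f :* (r :* r) := f :* (A :* g :* (r :* r))) refl (A i) (g i) (f i) (r i) ⟩
    f i * (A i * g i * r i ^2)      ≡⟨ ÷'-cancel (q i - q (next i)) (A i * g i * r i ^2) (A·g·r²≢0 i) ⟩
    q i - q (next i)                ∎

  ΣW₃≡0 : Σ n W₃ ≡ 0ℚ
  ΣW₃≡0 = trans (Σ-cong n W₃-difference) (telescope n q)

  ΣW₄≡0 : Σ n W₄ ≡ 0ℚ
  ΣW₄≡0 = trans (Σ-cong n W₄-difference) (telescope n p)

  c₁ c₂ c₃ c₄ : ℚ
  c₁ = ι (ℤ.+ 8)  * (u * u * u * u)
  c₂ = ι (ℤ.+ 8)  * (u * u * u * v)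
  c₃ = ι (ℤ.+ 24) * (u * u * v * v)
  c₄ = ι (ℤ.+ 8)  * (u * v * v * v)

  correction : Fin n → ℚ
  correction i = c₁ * W₁ i + c₂ * W₂ i + c₃ * W₃ i + c₄ * W₄ i

  -- Σ W₁ = -v and Σ W₂ = u hold by definition of u and v, so the first two
  -- terms give 8u⁴·(-v) + 8u³v·u = 0, and the W₃, W₄ sums telescope.
  correction-vanishes : Σ n correction ≡ 0ℚ
  correction-vanishes = begin
    Σ n correction                                   ≡⟨ Σ-combination n c₁ c₂ c₃ c₄ W₁ W₂ W₃ W₄ ⟩
    c₁ * Σ n W₁ + c₂ * u + c₃ * Σ n W₃ + c₄ * Σ n W₄ ≡⟨ cong₂ (λ s t → c₁ * Σ n W₁ + c₂ * u + c₃ * s + c₄ * t) ΣW₃≡0 ΣW₄≡0 ⟩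
    c₁ * Σ n W₁ + c₂ * u + c₃ * 0ℚ + c₄ * 0ℚ         ≡⟨ solve 4 (λ u S c₃ c₄ →
         con (ι (ℤ.+ 8)) :* (u :* u :* u :* u) :* S :+ con (ι (ℤ.+ 8)) :* (u :* u :* u :* (:- S)) :* u
           :+ c₃ :* con 0ℚ :+ c₄ :* con 0ℚ := con 0ℚ) refl u (Σ n W₁) c₃ c₄ ⟩
    0ℚ                                               ∎

mainTheorem1 : (n : ℕ) → n ≥ 3 →
    (a : Fin n → ℤ) → (∀ i → a i ≢ Data.Integer.0ℤ) →
    (r : Fin n → ℚ) → (∀ i → r i ≢ 0ℚ) →
    (p : Fin n → ℚ) → (∀ i → p i ≢ p (next i)) →
    (q : Fin n → ℚ) →
    let open Construction n a r p q in
    Σ n (λ i → A i * (x i) ^4) ≡ Σ n (λ i → A i * (y i) ^4)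
mainTheorem1 n _ a a≢0 r r≢0 p p≢p-next q = begin
  Σ n (λ i → A i * x i ^4)                  ≡⟨ Σ-cong n (λ i → fourth-power-difference (A i) (f i) (g i) (r i) u v) ⟩
  Σ n (λ i → A i * y i ^4 + correction i)   ≡⟨ Σ-+ n _ correction ⟩
  Σ n (λ i → A i * y i ^4) + Σ n correction ≡⟨ cong (Σ n (λ i → A i * y i ^4) +_) correction-vanishes ⟩
  Σ n (λ i → A i * y i ^4) + 0ℚ             ≡⟨ +-identityʳ _ ⟩
  Σ n (λ i → A i * y i ^4)                  ∎
  where
  open Construction n a r p q
  open Weights n a r p q a≢0 r≢0 p≢p-next
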